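{- Let $n \ge 3$, $m \ge 2$ and $1 \le x \le \lfloor n/2 \rfloor$ be integers, and let $C_n$ be the cycle on $n$ vertices. Then $D_m^x(C_n)$ is edge-regular, except in either of the following cases, for some integer $k \ge 2$ (in which it is not edge-regular): (1) $n = 3k$, $x = k$, and $m \neq 2$; (2) $n = 2k+1$, $x = k$, and $m \neq 3$.
   Context: All graphs are finite and simple. For a vertex $v$ of $G$, $N_G^x(v)$ denotes the set of vertices at distance exactly $x$ from $v$ in $G$. A graph is edge-regular if it is regular and there is $\lambda \ge 0$ such that every two adjacent vertices have exactly $\lambda$ common neighbors. For $x \ge 1$ and $m \ge 2$, the $(m,x)$-shadow $D_m^x(G)$ is the simple graph whose vertex set is the disjoint union of $m$ copies $G_1,\dots,G_m$ of $G$ (the copy of $u\in V(G)$ in $G_i$ denoted $u_i$), with edges $u_iv_i$ for $1\le i\le m$ and $uv \in E(G)$, and edges $u_iv_j$ for $1 \le i < j \le m$ whenever $u \in N_G^x(v)$. -}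

module Defs where

open import Data.Nat using (ℕ; zero; suc; _+_; _*_; _∸_; _≤_; _≡ᵇ_)
open import Data.Bool using (Bool; true; false; _∧_; _∨_; not; if_then_else_)
open import Data.Fin using (Fin; toℕ)
open import Data.Fin.Properties using () renaming (_≟_ to _≟ᶠ_)
open import Data.List using (List; length; filterᵇ; cartesianProduct; allFin)
open import Data.Bool.ListAction using (any)
open import Data.Product using (_×_; _,_; Σ; ∃-syntax)
open import Data.Product.Properties using (≡-dec)
open import Data.Sum using (_⊎_)
open import Relation.Binary.Definitions using (DecidableEquality)
open import Relation.Binary.PropositionalEquality using (_≡_; _≢_)
open import Relation.Nullary.Decidable using (⌊_⌋)

-- A finite simple graph: vertex type, a duplicate-free complete list of
-- its vertices, decidable equality, and Boolean adjacency.
record Graph : Set₁ where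
  field
    V        : Set
    vertices : List V
    _≟V_     : DecidableEquality V
    adj      : V → V → Bool
open Graph public

module _ (G : Graph) where
  reach : ℕ → V G → V G → Bool
  reach zero    v u = ⌊ _≟V_ G v u ⌋
  reach (suc k) v u = reach k v u ∨ any (λ w → reach k v w ∧ adj G w u) (vertices G)

  -- u ∈ N^x_G(v): distance from v to u is exactly x  (x ≥ 1)
  atDist : ℕ → V G → V G → Bool
  atDist x v u = reach x v u ∧ not (reach (x ∸ 1) v u)

  degree : V G → ℕ
  degree v = length (filterᵇ (adj G v) (vertices G))

  commonNbrs : V G → V G → ℕ
  commonNbrs u v = length (filterᵇ (λ w → adj G u w ∧ adj G v w) (vertices G))

  Regular : Set
  Regular = ∃[ d ] (∀ v → degree v ≡ d)

  EdgeRegular : Set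
  EdgeRegular = Regular × ∃[ λ′ ] (∀ u v → adj G u v ≡ true → commonNbrs u v ≡ λ′)

-- The cycle C_n on vertices 0,…,n-1 (i ~ j iff j ≡ i ± 1 mod n); simple for n ≥ 3.
cycleAdj : (n : ℕ) → Fin n → Fin n → Bool
cycleAdj n i j =
  (suc a ≡ᵇ b) ∨ (suc b ≡ᵇ a) ∨ ((a ≡ᵇ 0) ∧ (suc b ≡ᵇ n)) ∨ ((b ≡ᵇ 0) ∧ (suc a ≡ᵇ n))
  where
    a = toℕ i
    b = toℕ j

Cycle : ℕ → Graph
Cycle n = record
  { V = Fin n ; vertices = allFin n ; _≟V_ = _≟ᶠ_ ; adj = cycleAdj n }

shadow : ℕ → ℕ → Graph → Graph
shadow m x G = record
  { V = Fin m × V G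
  ; vertices = cartesianProduct (allFin m) (vertices G)
  ; _≟V_ = ≡-dec _≟ᶠ_ (_≟V_ G)
  ; adj = λ { (i , u) (j , v) →
      if ⌊ i ≟ᶠ j ⌋ then adj G u v else atDist G x v u }
  }

Exceptional : ℕ → ℕ → ℕ → Set
Exceptional n m x = ∃[ k ] (2 ≤ k ×
  ((n ≡ 3 * k × x ≡ k × m ≢ 2) ⊎ (n ≡ 2 * k + 1 × x ≡ k × m ≢ 3)))

-- Label the vertices of C_n by ℤ/n. For 1 ≤ x ≤ n/2 the vertices at distance x from u are
-- exactly u ± x, so both N(u) and N^x(u) are "spheres" {u ± K} (K = 1 resp. K = x). In the
-- shadow, u_i has degree deg u + (m−1)|N^x(u)|, which does not depend on u; an edge u_i v_i has
-- |N(u) ∩ N(v)| + (m−1)|N^x(u) ∩ N^x(v)| common neighbours, and an edge u_i v_j (i ≠ j) has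
-- |N(u) ∩ N^x(v)| + |N^x(u) ∩ N(v)| + (m−2)|N^x(u) ∩ N^x(v)|. If v = u + s, a common point
-- t = u ± K = v ± L of two spheres forces ±K ≡ s ± L (mod n); when K, L, s are the sides of a
-- nondegenerate triangle with all sides at most n/2, only t = u − K can occur, and it does iff
-- n = K + L + s. Hence the two counts are [n = 3] + (m−1)[n = 2x+1] and
-- 2[n = 2x+1] + (m−2)[n = 3x], which agree exactly outside the exceptional cases.

module Submission where

open import Defs
open import Data.Nat as ℕ using (ℕ; zero; suc; _+_; _*_; _≤_; _<_; _/_; NonZero; z≤n; s≤s)
open import Data.Nat.Properties as ℕ using (+-0-commutativeMonoid)
open import Data.Nat.Divisibility as ℕ using (>⇒∤)
open import Data.Nat.DivMod using (m/n*n≤m)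
import Data.Nat.Tactic.RingSolver as ℕ-Solver
open import Data.Bool using (Bool; true; false; T; not; _∧_; if_then_else_)
open import Data.Bool.Properties using (∧-comm; T-∨; T-∧; T-≡)
open import Data.Bool.ListAction using (any)
open import Data.Fin using (Fin; zero; suc; toℕ; fromℕ<; punchIn; punchOut)
open import Data.Fin.Properties
  using (_≟_; toℕ-injective; toℕ<n; toℕ-fromℕ<; punchInᵢ≢i; punchIn-injective; punchIn-punchOut)
open import Data.List using (List; []; _∷_; length; filterᵇ; map; _++_; tabulate; allFin; cartesianProduct)
open import Data.List.Properties using (filter-≐)
open import Data.List.Relation.Unary.Any using (satisfied)
open import Data.List.Relation.Unary.Any.Properties using (any⁺; any⁻; tabulate⁺)
open import Data.Product using (_×_; _,_; ∃-syntax; proj₁; proj₂)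
open import Data.Product.Function.NonDependent.Propositional using (_×-⇔_)
open import Data.Empty using (⊥-elim)
open import Data.Sum using (_⊎_; inj₁; inj₂; [_,_]′)
open import Data.Vec.Functional using (Vector; removeAt; replicate)
open import Function using (_∘_; id)
open import Function.Bundles using (_⇔_; mk⇔; Equivalence)
open import Function.Construct.Composition using (_⇔-∘_)
open import Relation.Nullary using (¬_; Dec; does; _because_; ofʸ; ofⁿ; yes; no; contradiction)
open import Relation.Nullary.Decidable using (T?; ⌊_⌋; _⊎-dec_; _×-dec_; toWitness; fromWitness)
open import Relation.Binary.PropositionalEquality
  using (_≡_; _≢_; refl; sym; trans; cong; cong₂; subst; module ≡-Reasoning)
open import Algebra.Properties.CommutativeMonoid.Sum +-0-commutativeMonoid
  using (sum; sum-syntax; sum-remove; sum-cong-≗)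

open Equivalence using () renaming (to to ⇒; from to ⇐)

private variable
  A B P : Set
  a b k m n C : ℕ

sum-replicate : ∀ k → sum (replicate k C) ≡ k * C
sum-replicate zero    = refl
sum-replicate (suc k) = cong (_ +_) (sum-replicate k)

sum-const-except : (t : Vector ℕ (suc k)) (i : Fin (suc k)) →
  (∀ l → l ≢ i → t l ≡ C) → sum t ≡ t i + k * C
sum-const-except {k} {C} t i t≡C = begin
  sum t                     ≡⟨ sum-remove {i = i} t ⟩
  t i + sum (removeAt t i)  ≡⟨ cong (t i +_) (sum-cong-≗ (λ l → t≡C _ (punchInᵢ≢i i l))) ⟩
  t i + sum (replicate k C) ≡⟨ cong (t i +_) (sum-replicate k) ⟩
  t i + k * C               ∎
  where open ≡-Reasoning

sum-const-except₂ : (t : Vector ℕ (suc (suc k))) {i j : Fin (suc (suc k))} → i ≢ j →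
  (∀ l → l ≢ i → l ≢ j → t l ≡ C) → sum t ≡ t i + (t j + k * C)
sum-const-except₂ {k} {C} t {i} {j} i≢j t≡C = begin
  sum t                            ≡⟨ sum-remove {i = i} t ⟩
  t i + sum (removeAt t i)         ≡⟨ cong (t i +_) (sum-const-except (removeAt t i) j′ off-j′) ⟩
  t i + (t (punchIn i j′) + k * C) ≡⟨ cong (λ l → t i + (t l + k * C)) (punchIn-punchOut i≢j) ⟩
  t i + (t j + k * C)              ∎
  where
  open ≡-Reasoning
  j′ = punchOut i≢j
  off-j′ : ∀ l → l ≢ j′ → t (punchIn i l) ≡ C
  off-j′ l l≢j′ = t≡C _ (punchInᵢ≢i i l) λ eq →
    l≢j′ (punchIn-injective i l j′ (trans eq (sym (punchIn-punchOut i≢j))))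

indicator : Bool → ℕ
indicator b = if b then 1 else 0

indicator-T : ∀ {b} → T b → indicator b ≡ 1
indicator-T {true} _ = refl

indicator-¬T : ∀ {b} → ¬ T b → indicator b ≡ 0
indicator-¬T {true}  ¬t = contradiction _ ¬t
indicator-¬T {false} _  = refl

length-filterᵇ-tabulate : (p : A → Bool) (f : Fin n → A) →
  length (filterᵇ p (tabulate f)) ≡ ∑[ i < n ] indicator (p (f i))
length-filterᵇ-tabulate {n = zero}  p f = refl
length-filterᵇ-tabulate {n = suc n} p f with p (f zero)
... | true  = cong suc (length-filterᵇ-tabulate p (f ∘ suc))
... | false = length-filterᵇ-tabulate p (f ∘ suc)

length-filterᵇ-map-++ : (p : B → Bool) (g : A → B) (xs : List A) (ys : List B) →
  length (filterᵇ p (map g xs ++ ys)) ≡ length (filterᵇ (p ∘ g) xs) + length (filterᵇ p ys)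
length-filterᵇ-map-++ p g []       ys = refl
length-filterᵇ-map-++ p g (x ∷ xs) ys with p (g x)
... | true  = cong suc (length-filterᵇ-map-++ p g xs ys)
... | false = length-filterᵇ-map-++ p g xs ys

length-filterᵇ-cartesianProduct : (p : A × B → Bool) (f : Fin m → A) (ys : List B) →
  length (filterᵇ p (cartesianProduct (tabulate f) ys))
    ≡ ∑[ l < m ] length (filterᵇ (λ y → p (f l , y)) ys)
length-filterᵇ-cartesianProduct {m = zero}  p f ys = refl
length-filterᵇ-cartesianProduct {m = suc m} p f ys =
  trans (length-filterᵇ-map-++ p (f zero ,_) ys (cartesianProduct (tabulate (f ∘ suc)) ys))
        (cong (length (filterᵇ (λ y → p (f zero , y)) ys) +_)
              (length-filterᵇ-cartesianProduct p (f ∘ suc) ys))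

countFin : (Fin n → Bool) → ℕ
countFin {n} p = length (filterᵇ p (allFin n))

countFin-none : {p : Fin n → Bool} → (∀ t → ¬ T (p t)) → countFin p ≡ 0
countFin-none {n} {p} none = begin
  countFin p                 ≡⟨ length-filterᵇ-tabulate p id ⟩
  ∑[ t < n ] indicator (p t) ≡⟨ sum-cong-≗ (indicator-¬T ∘ none) ⟩
  sum (replicate n 0)        ≡⟨ sum-replicate n ⟩
  n * 0                      ≡⟨ ℕ.*-zeroʳ n ⟩
  0                          ∎
  where open ≡-Reasoning

countFin-single : {p : Fin n → Bool} (c : Fin n) → (∀ t → T (p t) ⇔ t ≡ c) → countFin p ≡ 1
countFin-single {suc n} {p} c p⇔≡c = begin
  countFin p                     ≡⟨ length-filterᵇ-tabulate p id ⟩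
  ∑[ t < suc n ] indicator (p t) ≡⟨ sum-const-except _ c (λ t t≢c → indicator-¬T (t≢c ∘ ⇒ (p⇔≡c t))) ⟩
  indicator (p c) + n * 0        ≡⟨ cong₂ _+_ (indicator-T (⇐ (p⇔≡c c) refl)) (ℕ.*-zeroʳ n) ⟩
  1                              ∎
  where open ≡-Reasoning

countFin-pair : {p : Fin n → Bool} {c d : Fin n} → c ≢ d →
  (∀ t → T (p t) ⇔ (t ≡ c ⊎ t ≡ d)) → countFin p ≡ 2
countFin-pair {suc zero}    {c = zero} {zero} c≢d _ = contradiction refl c≢d
countFin-pair {suc (suc n)} {p} {c} {d} c≢d p⇔≡c∨d = begin
  countFin p                                  ≡⟨ length-filterᵇ-tabulate p id ⟩
  ∑[ t < suc (suc n) ] indicator (p t)        ≡⟨ sum-const-except₂ _ c≢d off ⟩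
  indicator (p c) + (indicator (p d) + n * 0) ≡⟨ cong₂ _+_ (at (inj₁ refl))
                                                   (cong₂ _+_ (at (inj₂ refl)) (ℕ.*-zeroʳ n)) ⟩
  2                                           ∎
  where
  open ≡-Reasoning
  off : ∀ t → t ≢ c → t ≢ d → indicator (p t) ≡ 0
  off t t≢c t≢d = indicator-¬T ([ t≢c , t≢d ]′ ∘ ⇒ (p⇔≡c∨d t))
  at : ∀ {t} → t ≡ c ⊎ t ≡ d → indicator (p t) ≡ 1
  at {t} t≡c∨d = indicator-T (⇐ (p⇔≡c∨d t) t≡c∨d)

countFin-when : {p : Fin n → Bool} (c : Fin n) {Q : Set} (Q? : Dec Q) →
  (∀ t → T (p t) ⇔ (t ≡ c × Q)) → countFin p ≡ indicator ⌊ Q? ⌋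
countFin-when c (yes q) p⇔ =
  countFin-single c λ t → mk⇔ (proj₁ ∘ ⇒ (p⇔ t)) (λ t≡c → ⇐ (p⇔ t) (t≡c , q))
countFin-when c (no ¬q) p⇔ = countFin-none λ t → ¬q ∘ proj₂ ∘ ⇒ (p⇔ t)

count : (G : Graph) → (V G → Bool) → ℕ
count G p = length (filterᵇ p (vertices G))

count-cong : ∀ G {p q : V G → Bool} → (∀ w → p w ≡ q w) → count G p ≡ count G q
count-cong G p≗q = cong length
  (filter-≐ (T? ∘ _) (T? ∘ _) ((λ {w} → subst T (p≗q w)) , (λ {w} → subst T (sym (p≗q w)))) (vertices G))

commonNbrs-comm : ∀ G u v → commonNbrs G u v ≡ commonNbrs G v u
commonNbrs-comm G u v = count-cong G (λ w → ∧-comm (adj G u w) (adj G v w))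

module Shadow (G : Graph) (x : ℕ) where

  count-shadow : (P : Fin m × V G → Bool) → count (shadow m x G) P ≡ ∑[ l < m ] count G (λ w → P (l , w))
  count-shadow P = length-filterᵇ-cartesianProduct P id (vertices G)

  shadow-adj-same : ∀ (i : Fin m) u v → adj (shadow m x G) (i , u) (i , v) ≡ adj G u v
  shadow-adj-same i u v with i ≟ i
  ... | yes _   = refl
  ... | no i≢i = contradiction refl i≢i

  shadow-adj-diff : ∀ {i j : Fin m} → i ≢ j → ∀ u v → adj (shadow m x G) (i , u) (j , v) ≡ atDist G x v u
  shadow-adj-diff {i = i} {j} i≢j u v with i ≟ j
  ... | yes i≡j = contradiction i≡j i≢j
  ... | no _    = refl

  degree-shadow : ∀ (i : Fin (suc m)) u →
    degree (shadow (suc m) x G) (i , u) ≡ degree G u + m * count G (λ w → atDist G x w u)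
  degree-shadow {m} i u = begin
    degree S (i , u)
      ≡⟨ count-shadow _ ⟩
    ∑[ l < suc m ] count G (λ w → adj S (i , u) (l , w))
      ≡⟨ sum-const-except _ i (λ l l≢i → count-cong G (λ w → shadow-adj-diff (l≢i ∘ sym) u w)) ⟩
    count G (λ w → adj S (i , u) (i , w)) + m * count G (λ w → atDist G x w u)
      ≡⟨ cong (_+ _) (count-cong G (λ w → shadow-adj-same i u w)) ⟩
    degree G u + m * count G (λ w → atDist G x w u)
      ∎
    where open ≡-Reasoning
          S = shadow (suc m) x G

  commonNbrs-shadow-same : ∀ (i : Fin (suc m)) u v →
    commonNbrs (shadow (suc m) x G) (i , u) (i , v)
      ≡ commonNbrs G u v + m * count G (λ w → atDist G x w u ∧ atDist G x w v)
  commonNbrs-shadow-same {m} i u v = begin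
    commonNbrs S (i , u) (i , v)
      ≡⟨ count-shadow _ ⟩
    ∑[ l < suc m ] count G (λ w → adj S (i , u) (l , w) ∧ adj S (i , v) (l , w))
      ≡⟨ sum-const-except _ i (λ l l≢i → count-cong G (λ w →
           cong₂ _∧_ (shadow-adj-diff (l≢i ∘ sym) u w) (shadow-adj-diff (l≢i ∘ sym) v w))) ⟩
    count G (λ w → adj S (i , u) (i , w) ∧ adj S (i , v) (i , w))
      + m * count G (λ w → atDist G x w u ∧ atDist G x w v)
      ≡⟨ cong (_+ _) (count-cong G (λ w → cong₂ _∧_ (shadow-adj-same i u w) (shadow-adj-same i v w))) ⟩
    commonNbrs G u v + m * count G (λ w → atDist G x w u ∧ atDist G x w v)
      ∎
    where open ≡-Reasoning
          S = shadow (suc m) x G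

  commonNbrs-shadow-diff : ∀ {i j : Fin (suc (suc m))} → i ≢ j → ∀ u v →
    commonNbrs (shadow (suc (suc m)) x G) (i , u) (j , v)
      ≡ count G (λ w → adj G u w ∧ atDist G x w v)
        + (count G (λ w → atDist G x w u ∧ adj G v w)
           + m * count G (λ w → atDist G x w u ∧ atDist G x w v))
  commonNbrs-shadow-diff {m} {i} {j} i≢j u v = begin
    commonNbrs S (i , u) (j , v)
      ≡⟨ count-shadow _ ⟩
    ∑[ l < suc (suc m) ] count G (λ w → adj S (i , u) (l , w) ∧ adj S (j , v) (l , w))
      ≡⟨ sum-const-except₂ _ i≢j (λ l l≢i l≢j → count-cong G (λ w →
           cong₂ _∧_ (shadow-adj-diff (l≢i ∘ sym) u w) (shadow-adj-diff (l≢j ∘ sym) v w))) ⟩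
    count G (λ w → adj S (i , u) (i , w) ∧ adj S (j , v) (i , w))
      + (count G (λ w → adj S (i , u) (j , w) ∧ adj S (j , v) (j , w))
         + m * count G (λ w → atDist G x w u ∧ atDist G x w v))
      ≡⟨ cong₂ (λ a b → a + (b + _))
           (count-cong G (λ w → cong₂ _∧_ (shadow-adj-same i u w) (shadow-adj-diff (i≢j ∘ sym) v w)))
           (count-cong G (λ w → cong₂ _∧_ (shadow-adj-diff i≢j u w) (shadow-adj-same j v w))) ⟩
    count G (λ w → adj G u w ∧ atDist G x w v)
      + (count G (λ w → atDist G x w u ∧ adj G v w)
         + m * count G (λ w → atDist G x w u ∧ atDist G x w v))
      ∎
    where open ≡-Reasoning
          S = shadow (suc (suc m)) x G

δ : ℕ → ℕ → ℕ
δ a b = indicator ⌊ a ℕ.≟ b ⌋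

δ-≡ : a ≡ b → δ a b ≡ 1
δ-≡ {a} {b} a≡b with a ℕ.≟ b
... | yes _   = refl
... | no a≢b = contradiction a≡b a≢b

δ-≢ : a ≢ b → δ a b ≡ 0
δ-≢ {a} {b} a≢b with a ℕ.≟ b
... | yes a≡b = contradiction a≡b a≢b
... | no _    = refl

T-does : (P? : Dec P) → T (does P?) ⇔ P
T-does (true  because ofʸ p)  = mk⇔ (λ _ → p) _
T-does (false because ofⁿ ¬p) = mk⇔ (λ ()) ¬p

T-not : ∀ {b} → T (not b) ⇔ (¬ T b)
T-not {true}  = mk⇔ (λ ()) (λ ¬t → ¬t _)
T-not {false} = mk⇔ (λ _ ()) _

T-any-allFin : (p : Fin n → Bool) → T (any p (allFin n)) ⇔ (∃[ w ] T (p w))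
T-any-allFin {n} p =
  mk⇔ (satisfied ∘ any⁻ p (allFin n)) (λ (w , pw) → any⁺ {xs = allFin n} p (tabulate⁺ w pw))

record Triangle (K L s : ℕ) : Set where
  field
    K<L+s : K < L + s
    L<K+s : L < K + s
    s<K+L : s < K + L

triangle-positive : ∀ {K L s} → Triangle K L s → 0 < K × 0 < L × 0 < s
triangle-positive {K} {L} {s} record { K<L+s = K<L+s ; L<K+s = L<K+s ; s<K+L = s<K+L } =
  positive L<K+s s<K+L ,
  positive K<L+s (subst (s <_) (ℕ.+-comm K L) s<K+L) ,
  positive (subst (K <_) (ℕ.+-comm L s) K<L+s) (subst (L <_) (ℕ.+-comm K s) L<K+s)
  where
  positive : b < a + C → C < a + b → 0 < a
  positive {a = zero}  b<c c<b = contradiction b<c (ℕ.<-asym c<b)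
  positive {a = suc _} _   _   = ℕ.z<s

multiple<⇒0 : ∀ {d} → n ℕ.∣ d → d < n → d ≡ 0
multiple<⇒0 {d = zero}  _   _   = refl
multiple<⇒0 {d = suc _} n∣d d<n = contradiction n∣d (>⇒∤ d<n)

module Cyclic (n : ℕ) .{{_ : NonZero n}} where

  open import Data.Integer as ℤ using (ℤ; +_; -_; _-_; _⊖_; 0ℤ; ∣_∣; +[1+_]; -[1+_])
  open import Data.Integer.Properties
    using ( ⊖-≥; ⊖-swap; +-identityʳ; m-n≡m⊖n; +-inverseˡ; neg-involutive; pos-+
          ; ∣i∣≡0⇒i≡0; ∣i+j∣≤∣i∣+∣j∣; ∣i-j∣≤∣i∣+∣j∣; ∣-i∣≡∣i∣; i-j≡0⇒i≡j)
  open import Data.Integer.Divisibility.Signed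
    using (_∣_; divides; ∣⇒∣ᵤ; ∣m⇒∣-m; ∣m∣n⇒∣m+n; ∣m∣n⇒∣m-n; ∣-refl)
  open import Data.Integer.DivMod using (_%ℕ_; _/ℕ_; n%ℕd<d; a≡a%ℕn+[a/ℕn]*n)
  open import Data.Integer.Tactic.RingSolver using (solve-∀)

  ≤⊖-multiple⇒≡ : a ≤ b → + n ∣ (b ⊖ a) → b < a + n → a ≡ b
  ≤⊖-multiple⇒≡ {a} {b} a≤b n∣b⊖a b<a+n = ℕ.≤-antisym a≤b (ℕ.m∸n≡0⇒m≤n
    (multiple<⇒0 (∣⇒∣ᵤ (subst (+ n ∣_) (⊖-≥ a≤b) n∣b⊖a)) (ℕ.m<n+o⇒m∸n<o b a b<a+n)))

  ⊖-multiple⇒≡ : + n ∣ (a ⊖ b) → a < b + n → b < a + n → a ≡ b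
  ⊖-multiple⇒≡ {a} {b} n∣a⊖b a<b+n b<a+n with ℕ.≤-total a b
  ... | inj₁ a≤b = ≤⊖-multiple⇒≡ a≤b (subst (+ n ∣_) (sym (⊖-swap b a)) (∣m⇒∣-m n∣a⊖b)) b<a+n
  ... | inj₂ b≤a = sym (≤⊖-multiple⇒≡ b≤a n∣a⊖b a<b+n)

  not-multiple : ∀ {z} → a ≤ n → 0 < b → b < a → z ≡ + a - + b → ¬ (+ n ∣ z)
  not-multiple {a} {b} a≤n 0<b b<a z≡ n∣z = ℕ.<⇒≢ b<a (sym (⊖-multiple⇒≡
    (subst (+ n ∣_) (trans z≡ (m-n≡m⊖n a b)) n∣z)
    (ℕ.≤-<-trans a≤n (ℕ.m<n+m n 0<b)) (ℕ.<-≤-trans b<a (ℕ.m≤m+n _ n))))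

  n∣⇒≡n : + n ∣ + a → 0 < a → a < n + n → a ≡ n
  n∣⇒≡n {a} n∣a 0<a a<n+n =
    ⊖-multiple⇒≡ (subst (+ n ∣_) (m-n≡m⊖n a n) (∣m∣n⇒∣m-n n∣a ∣-refl)) a<n+n (ℕ.+-monoˡ-< n 0<a)

  multiple<⇒0ℤ : ∀ {z} → + n ∣ z → ∣ z ∣ < n → z ≡ 0ℤ
  multiple<⇒0ℤ n∣z ∣z∣<n = ∣i∣≡0⇒i≡0 (multiple<⇒0 (∣⇒∣ᵤ n∣z) ∣z∣<n)

  toℤ : Fin n → ℤ
  toℤ a = + toℕ a

  record Shift (e : ℤ) (u v : Fin n) : Set where
    constructor shift
    field divisible : + n ∣ toℤ v - toℤ u - e

  private variable
    e e′ : ℤ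
    u v w : Fin n

  shift-refl : Shift 0ℤ u u
  shift-refl {u} = shift (divides 0ℤ (identity (toℤ u) (+ n)))
    where identity : ∀ u n → u - u - 0ℤ ≡ 0ℤ ℤ.* n
          identity = solve-∀

  shift-sym : Shift e u v → Shift (- e) v u
  shift-sym {e} {u} {v} (shift n∣) = shift (subst (+ n ∣_) (identity (toℤ u) (toℤ v) e) (∣m⇒∣-m n∣))
    where identity : ∀ u v e → - (v - u - e) ≡ u - v - - e
          identity = solve-∀

  shift-sym⁻ : Shift (- e) u v → Shift e v u
  shift-sym⁻ {e} s = subst (λ e → Shift e _ _) (neg-involutive e) (shift-sym s)

  shift-trans : Shift e u v → Shift e′ v w → Shift (e ℤ.+ e′) u w
  shift-trans {e} {u} {v} {e′} {w} (shift n∣₁) (shift n∣₂) =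
    shift (subst (+ n ∣_) (identity (toℤ u) (toℤ v) (toℤ w) e e′) (∣m∣n⇒∣m+n n∣₁ n∣₂))
    where identity : ∀ u v w e e′ → (v - u - e) ℤ.+ (w - v - e′) ≡ w - u - (e ℤ.+ e′)
          identity = solve-∀

  shift-diff : Shift e u v → Shift e′ u v → + n ∣ e′ - e
  shift-diff {e} {u} {v} {e′} (shift n∣₁) (shift n∣₂) =
    subst (+ n ∣_) (identity (toℤ u) (toℤ v) e e′) (∣m∣n⇒∣m-n n∣₁ n∣₂)
    where identity : ∀ u v e e′ → (v - u - e) - (v - u - e′) ≡ e′ - e
          identity = solve-∀

  shift-resp : + n ∣ e - e′ → Shift e u v → Shift e′ u v
  shift-resp {e} {e′} {u} {v} n∣e-e′ (shift n∣) =
    shift (subst (+ n ∣_) (identity (toℤ u) (toℤ v) e e′) (∣m∣n⇒∣m+n n∣ n∣e-e′))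
    where identity : ∀ u v e e′ → (v - u - e) ℤ.+ (e - e′) ≡ v - u - e′
          identity = solve-∀

  shift-by : ∀ q → toℤ v ≡ toℤ u ℤ.+ e ℤ.+ q ℤ.* + n → Shift e u v
  shift-by {v} {u} {e} q v≡ =
    shift (divides q (trans (cong (λ v → v - toℤ u - e) v≡) (identity (toℤ u) e q (+ n))))
    where identity : ∀ u e q n → u ℤ.+ e ℤ.+ q ℤ.* n - u - e ≡ q ℤ.* n
          identity = solve-∀

  shift-zero⇒≡ : Shift 0ℤ u v → u ≡ v
  shift-zero⇒≡ {u} {v} (shift n∣) = sym (toℕ-injective (⊖-multiple⇒≡
    (subst (+ n ∣_) (identity (toℕ u) (toℕ v)) n∣)
    (ℕ.<-≤-trans (toℕ<n v) (ℕ.m≤n+m n _)) (ℕ.<-≤-trans (toℕ<n u) (ℕ.m≤n+m n _))))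
    where identity : ∀ a b → + b - + a - 0ℤ ≡ b ⊖ a
          identity a b = trans (+-identityʳ _) (m-n≡m⊖n b a)

  shift-functional : Shift e u v → Shift e u w → v ≡ w
  shift-functional {e} s₁ s₂ =
    shift-zero⇒≡ (subst (λ e → Shift e _ _) (+-inverseˡ e) (shift-trans (shift-sym s₁) s₂))

  infixl 6 _⊕_
  _⊕_ : Fin n → ℤ → Fin n
  u ⊕ e = fromℕ< (n%ℕd<d (toℤ u ℤ.+ e) n)

  shift-⊕ : ∀ u e → Shift e u (u ⊕ e)
  shift-⊕ u e = shift (divides (- q) (begin
    toℤ (u ⊕ e) - toℤ u - e    ≡⟨ cong (λ r → + r - toℤ u - e) (toℕ-fromℕ< _) ⟩
    + r - toℤ u - e            ≡⟨ regroup (+ r) (toℤ u) e ⟩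
    + r - (toℤ u ℤ.+ e)        ≡⟨ cong (λ s → + r - s) (a≡a%ℕn+[a/ℕn]*n (toℤ u ℤ.+ e) n) ⟩
    + r - (+ r ℤ.+ q ℤ.* + n)  ≡⟨ cancel (+ r) q (+ n) ⟩
    - q ℤ.* + n                ∎))
    where
    open ≡-Reasoning
    r = (toℤ u ℤ.+ e) %ℕ n
    q = (toℤ u ℤ.+ e) /ℕ n
    regroup : ∀ r u e → r - u - e ≡ r - (u ℤ.+ e)
    regroup = solve-∀
    cancel : ∀ r q n → r - (r ℤ.+ q ℤ.* n) ≡ - q ℤ.* n
    cancel = solve-∀

  Sphere : ℕ → Fin n → Fin n → Set
  Sphere K u v = Shift (+ K) u v ⊎ Shift (- + K) u v

  sphere-sym : ∀ {K} → Sphere K u v → Sphere K v u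
  sphere-sym (inj₁ s) = inj₂ (shift-sym s)
  sphere-sym (inj₂ s) = inj₁ (shift-sym⁻ s)

  sphere-comm : ∀ {K} → Sphere K u v ⇔ Sphere K v u
  sphere-comm = mk⇔ sphere-sym sphere-sym

  sphere-oriented : ∀ {K} → Sphere K u v → Shift (+ K) u v ⊎ Shift (+ K) v u
  sphere-oriented (inj₁ s) = inj₁ s
  sphere-oriented (inj₂ s) = inj₂ (shift-sym⁻ s)

  sphere⇒shift : ∀ {K} → Sphere K u v → ∃[ σ ] (∣ σ ∣ ≡ K × Shift σ u v)
  sphere⇒shift (inj₁ s) = _ , refl , s
  sphere⇒shift (inj₂ s) = _ , ∣-i∣≡∣i∣ (+ _) , s

  shift⇒sphere : Shift e u v → Sphere ∣ e ∣ u v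
  shift⇒sphere {+ _}      s = inj₁ s
  shift⇒sphere { -[1+ _ ]} s = inj₂ s

  sphere-points : ∀ {K t} → Sphere K u t ⇔ (t ≡ u ⊕ + K ⊎ t ≡ u ⊕ - + K)
  sphere-points {u} {K} {t} = mk⇔ to from
    where
    to : Sphere K u t → t ≡ u ⊕ + K ⊎ t ≡ u ⊕ - + K
    to (inj₁ s) = inj₁ (shift-functional s (shift-⊕ u (+ K)))
    to (inj₂ s) = inj₂ (shift-functional s (shift-⊕ u (- + K)))
    from : t ≡ u ⊕ + K ⊎ t ≡ u ⊕ - + K → Sphere K u t
    from (inj₁ refl) = inj₁ (shift-⊕ u (+ K))
    from (inj₂ refl) = inj₂ (shift-⊕ u (- + K))

  Succ : Fin n → Fin n → Set
  Succ u v = suc (toℕ u) ≡ toℕ v ⊎ (toℕ v ≡ 0 × suc (toℕ u) ≡ n)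

  succ⇒shift : Succ u v → Shift (+ 1) u v
  succ⇒shift {u} {v} (inj₁ su≡v) = shift-by 0ℤ (begin
    + toℕ v                       ≡⟨ cong +_ su≡v ⟨
    + 1 ℤ.+ toℤ u                 ≡⟨ identity (toℤ u) (+ n) ⟩
    toℤ u ℤ.+ + 1 ℤ.+ 0ℤ ℤ.* + n  ∎)
    where open ≡-Reasoning
          identity : ∀ u n → + 1 ℤ.+ u ≡ u ℤ.+ + 1 ℤ.+ 0ℤ ℤ.* n
          identity = solve-∀
  succ⇒shift {u} {v} (inj₂ (v≡0 , su≡n)) = shift-by (- + 1) (begin
    + toℕ v                                      ≡⟨ cong +_ v≡0 ⟩
    0ℤ                                           ≡⟨ identity (toℤ u) ⟩
    toℤ u ℤ.+ + 1 ℤ.+ - + 1 ℤ.* (+ 1 ℤ.+ toℤ u)  ≡⟨ cong (λ i → toℤ u ℤ.+ + 1 ℤ.+ - + 1 ℤ.* i) 1+u≡n ⟩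
    toℤ u ℤ.+ + 1 ℤ.+ - + 1 ℤ.* + n              ∎)
    where open ≡-Reasoning
          1+u≡n = trans (sym (pos-+ 1 (toℕ u))) (cong +_ su≡n)
          identity : ∀ u → 0ℤ ≡ u ℤ.+ + 1 ℤ.+ - + 1 ℤ.* (+ 1 ℤ.+ u)
          identity = solve-∀

  succ-exists : ∀ u → ∃[ w ] Succ u w
  succ-exists u with suc (toℕ u) ℕ.<? n
  ... | yes su<n = fromℕ< su<n , inj₁ (sym (toℕ-fromℕ< su<n))
  ... | no  su≮n = fromℕ< (ℕ.≤-<-trans z≤n (toℕ<n u)) ,
                   inj₂ (toℕ-fromℕ< _ , ℕ.≤-antisym (toℕ<n u) (ℕ.≮⇒≥ su≮n))

  shift⇒succ : Shift (+ 1) u v → Succ u v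
  shift⇒succ {u} s with succ-exists u
  ... | (w , u↦w) = subst (Succ u) (shift-functional (succ⇒shift u↦w) s) u↦w

  Adjacent : Fin n → Fin n → Set
  Adjacent u v = suc (toℕ u) ≡ toℕ v ⊎ suc (toℕ v) ≡ toℕ u
               ⊎ (toℕ u ≡ 0 × suc (toℕ v) ≡ n) ⊎ (toℕ v ≡ 0 × suc (toℕ u) ≡ n)

  -- does (adjacent? u v) unfolds definitionally to cycleAdj n u v.
  adjacent? : ∀ u v → Dec (Adjacent u v)
  adjacent? u v = (suc (toℕ u) ℕ.≟ toℕ v) ⊎-dec (suc (toℕ v) ℕ.≟ toℕ u)
    ⊎-dec ((toℕ u ℕ.≟ 0) ×-dec (suc (toℕ v) ℕ.≟ n)) ⊎-dec ((toℕ v ℕ.≟ 0) ×-dec (suc (toℕ u) ℕ.≟ n))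

  T-cycleAdj : T (cycleAdj n u v) ⇔ Sphere 1 u v
  T-cycleAdj {u} {v} = mk⇔ (to ∘ ⇒ (T-does (adjacent? u v))) (⇐ (T-does (adjacent? u v)) ∘ from)
    where
    to : Adjacent u v → Sphere 1 u v
    to (inj₁ su≡v)                   = inj₁ (succ⇒shift (inj₁ su≡v))
    to (inj₂ (inj₁ sv≡u))            = inj₂ (shift-sym (succ⇒shift (inj₁ sv≡u)))
    to (inj₂ (inj₂ (inj₁ u≡0∧sv≡n))) = inj₂ (shift-sym (succ⇒shift (inj₂ u≡0∧sv≡n)))
    to (inj₂ (inj₂ (inj₂ v≡0∧su≡n))) = inj₁ (succ⇒shift (inj₂ v≡0∧su≡n))
    from : Sphere 1 u v → Adjacent u v
    from (inj₁ s) with shift⇒succ s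
    ... | inj₁ su≡v     = inj₁ su≡v
    ... | inj₂ v≡0∧su≡n = inj₂ (inj₂ (inj₂ v≡0∧su≡n))
    from (inj₂ s) with shift⇒succ (shift-sym⁻ s)
    ... | inj₁ sv≡u     = inj₂ (inj₁ sv≡u)
    ... | inj₂ u≡0∧sv≡n = inj₂ (inj₂ (inj₁ u≡0∧sv≡n))

  split-last-step : ∀ {k} e → ∣ e ∣ ≤ suc k →
    ∣ e ∣ ≤ k ⊎ ∃[ e₀ ] (∣ e₀ ∣ ≤ k × (- e₀ ℤ.+ e ≡ + 1 ⊎ - e₀ ℤ.+ e ≡ - + 1))
  split-last-step (+ zero)  _         = inj₁ z≤n
  split-last-step +[1+ j ] (s≤s j≤k) =
    inj₂ (+ j , j≤k , inj₁ (trans (cong (λ i → - + j ℤ.+ i) (pos-+ 1 j)) (identity (+ j))))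
    where identity : ∀ j → - j ℤ.+ (+ 1 ℤ.+ j) ≡ + 1
          identity = solve-∀
  split-last-step -[1+ j ] (s≤s j≤k) =
    inj₂ (- + j , subst (_≤ _) (sym (∣-i∣≡∣i∣ (+ j))) j≤k ,
          inj₂ (trans (cong (λ i → - - + j ℤ.+ - i) (pos-+ 1 j)) (identity (+ j))))
    where identity : ∀ j → - - j ℤ.+ - (+ 1 ℤ.+ j) ≡ - + 1
          identity = solve-∀

  T-reach : ∀ k → T (reach (Cycle n) k u v) ⇔ (∃[ e ] (∣ e ∣ ≤ k × Shift e u v))
  T-reach {u} {v} zero = mk⇔
    (λ u≡v → 0ℤ , z≤n , subst (Shift 0ℤ u) (toWitness u≡v) shift-refl)
    (λ (e , ∣e∣≤0 , s) → fromWitness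
      (shift-zero⇒≡ (subst (λ e → Shift e u v) (∣i∣≡0⇒i≡0 (ℕ.n≤0⇒n≡0 ∣e∣≤0)) s)))
  T-reach {u} {v} (suc k) = mk⇔ to from
    where
    via : Fin n → Bool
    via w = reach (Cycle n) k u w ∧ cycleAdj n w v
    T-reach-suc : T (reach (Cycle n) (suc k) u v) ⇔ (T (reach (Cycle n) k u v) ⊎ T (any via (allFin n)))
    T-reach-suc = T-∨
    to : T (reach (Cycle n) (suc k) u v) → ∃[ e ] (∣ e ∣ ≤ suc k × Shift e u v)
    to h with ⇒ T-reach-suc h
    ... | inj₁ h = let (e , ∣e∣≤k , s) = ⇒ (T-reach k) h in e , ℕ.m≤n⇒m≤1+n ∣e∣≤k , s
    ... | inj₂ h with ⇒ (T-any-allFin via) h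
    ... | (w , h) with ⇒ T-∧ h
    ... | (u→w , w~v) with ⇒ (T-reach k) u→w | sphere⇒shift (⇒ T-cycleAdj w~v)
    ... | (e , ∣e∣≤k , s) | (σ , ∣σ∣≡1 , s₁) = e ℤ.+ σ , ∣e+σ∣≤1+k , shift-trans s s₁
      where ∣e+σ∣≤1+k : ∣ e ℤ.+ σ ∣ ≤ suc k
            ∣e+σ∣≤1+k = ℕ.≤-trans (∣i+j∣≤∣i∣+∣j∣ e σ)
              (ℕ.≤-trans (ℕ.+-mono-≤ ∣e∣≤k (ℕ.≤-reflexive ∣σ∣≡1)) (ℕ.≤-reflexive (ℕ.+-comm k 1)))
    from : ∃[ e ] (∣ e ∣ ≤ suc k × Shift e u v) → T (reach (Cycle n) (suc k) u v)
    from (e , ∣e∣≤1+k , s) with split-last-step e ∣e∣≤1+k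
    ... | inj₁ ∣e∣≤k = ⇐ T-reach-suc (inj₁ (⇐ (T-reach k) (e , ∣e∣≤k , s)))
    ... | inj₂ (e₀ , ∣e₀∣≤k , last) =
      ⇐ T-reach-suc (inj₂ (⇐ (T-any-allFin via) (u ⊕ e₀ , ⇐ T-∧ (u→w , w~v))))
      where
      u→w : T (reach (Cycle n) k u (u ⊕ e₀))
      u→w = ⇐ (T-reach k) (e₀ , ∣e₀∣≤k , shift-⊕ u e₀)
      w→v : ∀ {σ} → - e₀ ℤ.+ e ≡ σ → Shift σ (u ⊕ e₀) v
      w→v refl = shift-trans (shift-sym (shift-⊕ u e₀)) s
      w~v : T (cycleAdj n (u ⊕ e₀) v)
      w~v = ⇐ T-cycleAdj ([ inj₁ ∘ w→v , inj₂ ∘ w→v ]′ last)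

  T-atDist : ∀ {x} → 1 ≤ x → x + x ≤ n → T (atDist (Cycle n) x u v) ⇔ Sphere x u v
  T-atDist {u} {v} {x@(suc y)} _ x+x≤n = mk⇔ to from
    where
    to : T (atDist (Cycle n) x u v) → Sphere x u v
    to h with ⇒ T-∧ h
    ... | (within , beyond) with ⇒ (T-reach x) within
    ... | (e , ∣e∣≤x , s) with ∣ e ∣ ℕ.≤? y
    ... | yes ∣e∣≤y = contradiction (⇐ (T-reach y) (e , ∣e∣≤y , s)) (⇒ T-not beyond)
    ... | no  ∣e∣≰y = subst (λ r → Sphere r u v) (ℕ.≤-antisym ∣e∣≤x (ℕ.≰⇒> ∣e∣≰y)) (shift⇒sphere s)
    from : Sphere x u v → T (atDist (Cycle n) x u v)
    from sphere with sphere⇒shift sphere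
    ... | (σ , ∣σ∣≡x , s) = ⇐ T-∧ (⇐ (T-reach x) (σ , ℕ.≤-reflexive ∣σ∣≡x , s) , ⇐ T-not beyond)
      where
      beyond : ¬ T (reach (Cycle n) y u v)
      beyond h with ⇒ (T-reach y) h
      ... | (e , ∣e∣≤y , s′) =
        ℕ.<⇒≱ (s≤s ∣e∣≤y) (ℕ.≤-reflexive (trans (sym ∣σ∣≡x) (cong ∣_∣ σ≡e)))
        where
        ∣e-σ∣<n : ∣ e - σ ∣ < n
        ∣e-σ∣<n = ℕ.≤-<-trans (∣i-j∣≤∣i∣+∣j∣ e σ)
          (ℕ.<-≤-trans (ℕ.+-mono-<-≤ (s≤s ∣e∣≤y) (ℕ.≤-reflexive ∣σ∣≡x)) x+x≤n)
        σ≡e : σ ≡ e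
        σ≡e = sym (i-j≡0⇒i≡j e σ (multiple<⇒0ℤ (shift-diff s s′) ∣e-σ∣<n))

  2K≡K--K : ∀ {K} → + (K + K) ≡ + K - - + K
  2K≡K--K {K} = trans (pos-+ K K) (cong (λ i → + K ℤ.+ i) (sym (neg-involutive (+ K))))

  countFin-sphere : ∀ {K} {p : Fin n → Bool} → 1 ≤ K → K + K ≤ n → (∀ t → T (p t) ⇔ Sphere K u t) →
    countFin p ≡ (if ⌊ K + K ℕ.≟ n ⌋ then 1 else 2)
  countFin-sphere {u} {K} {p} 1≤K K+K≤n p⇔sphere with K + K ℕ.≟ n
  ... | yes K+K≡n = countFin-single (u ⊕ + K) λ t → mk⇔
          (λ pt → [ id , (λ t≡ → trans t≡ antipodal) ]′ (⇒ sphere-points (⇒ (p⇔sphere t) pt)))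
          (λ t≡ → ⇐ (p⇔sphere t) (⇐ sphere-points (inj₁ t≡)))
    where
    n∣2K : + n ∣ + K - - + K
    n∣2K = subst (+ n ∣_) (trans (cong +_ (sym K+K≡n)) (2K≡K--K {K})) ∣-refl
    antipodal : u ⊕ - + K ≡ u ⊕ + K
    antipodal = shift-functional (shift-⊕ u (- + K)) (shift-resp n∣2K (shift-⊕ u (+ K)))
  ... | no  K+K≢n = countFin-pair distinct λ t → sphere-points ⇔-∘ p⇔sphere t
    where
    distinct : u ⊕ + K ≢ u ⊕ - + K
    distinct eq = K+K≢n (n∣⇒≡n (subst (+ n ∣_) (sym (2K≡K--K {K})) n∣2K)
                               (ℕ.+-mono-≤ 1≤K z≤n) (ℕ.≤-<-trans K+K≤n (ℕ.m<m+n n (ℕ.>-nonZero⁻¹ n))))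
      where n∣2K : + n ∣ + K - - + K
            n∣2K = shift-diff (subst (Shift (- + K) u) (sym eq) (shift-⊕ u (- + K))) (shift-⊕ u (+ K))

  +[a+b+c] : ∀ a b c → + (a + b + c) ≡ + a ℤ.+ + b ℤ.+ + c
  +[a+b+c] a b c = trans (pos-+ (a + b) c) (cong (λ i → i ℤ.+ + c) (pos-+ a b))

  meeting-point : ∀ {K L s} → Shift (+ s) u v → K + L + s ≡ n → Shift (+ L) v (u ⊕ - + K)
  meeting-point {u} {v} {K} {L} {s} u→v K+L+s≡n =
    shift-resp n∣ (shift-trans (shift-sym u→v) (shift-⊕ u (- + K)))
    where
    identity : ∀ K L s → - (K ℤ.+ L ℤ.+ s) ≡ - s ℤ.+ - K - L
    identity = solve-∀
    n∣ : + n ∣ - + s ℤ.+ - + K - + L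
    n∣ = subst (+ n ∣_) (trans (cong (λ i → - + i) (sym K+L+s≡n))
                               (trans (cong -_ (+[a+b+c] K L s)) (identity (+ K) (+ L) (+ s))))
                        (∣m⇒∣-m ∣-refl)

  sphere-meet : ∀ {K L s r t} → Triangle K L s → K ≤ r → L ≤ r → s ≤ r → r + r ≤ n →
    Shift (+ s) u v → (Sphere K u t × Sphere L v t) ⇔ (t ≡ u ⊕ - + K × K + L + s ≡ n)
  sphere-meet {u} {v} {K} {L} {s} {r} {t} tri K≤r L≤r s≤r r+r≤n u→v = mk⇔ to from
    where
    open Triangle tri
    0<K = proj₁ (triangle-positive tri)
    0<L = proj₁ (proj₂ (triangle-positive tri))
    0<s = proj₂ (proj₂ (triangle-positive tri))
    sum≤n : ∀ {a b} → a ≤ r → b ≤ r → a + b ≤ n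
    sum≤n a≤r b≤r = ℕ.≤-trans (ℕ.+-mono-≤ a≤r b≤r) r+r≤n
    n∣routes : ∀ {ε δ} → Shift ε u t → Shift δ v t → + n ∣ + s ℤ.+ δ - ε
    n∣routes u→t v→t = shift-diff u→t (shift-trans u→v v→t)
    to : Sphere K u t × Sphere L v t → t ≡ u ⊕ - + K × K + L + s ≡ n
    to (inj₁ u→t , inj₁ v→t) =
      ⊥-elim (not-multiple (sum≤n s≤r L≤r) 0<K (subst (K <_) (ℕ.+-comm L s) K<L+s)
                (cong (λ i → i - + K) (sym (pos-+ s L))) (n∣routes u→t v→t))
    to (inj₁ u→t , inj₂ v→t) =
      ⊥-elim (not-multiple (sum≤n L≤r K≤r) 0<s (subst (s <_) (ℕ.+-comm K L) s<K+L)
                (trans (identity (+ s) (+ L) (+ K)) (cong (λ i → i - + s) (sym (pos-+ L K))))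
                (∣m⇒∣-m (n∣routes u→t v→t)))
      where identity : ∀ s L K → - (s ℤ.+ - L - K) ≡ L ℤ.+ K - s
            identity = solve-∀
    to (inj₂ u→t , inj₂ v→t) =
      ⊥-elim (not-multiple (sum≤n s≤r K≤r) 0<L (subst (L <_) (ℕ.+-comm K s) L<K+s)
                (trans (identity (+ s) (+ L) (+ K)) (cong (λ i → i - + L) (sym (pos-+ s K))))
                (n∣routes u→t v→t))
      where identity : ∀ s L K → s ℤ.+ - L - - K ≡ s ℤ.+ K - L
            identity = solve-∀
    to (inj₂ u→t , inj₁ v→t) = shift-functional u→t (shift-⊕ u (- + K)) ,
      n∣⇒≡n (subst (+ n ∣_) (trans (identity (+ s) (+ L) (+ K)) (sym (+[a+b+c] K L s))) (n∣routes u→t v→t))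
            (ℕ.<-≤-trans 0<s (ℕ.m≤n+m s (K + L)))
            (ℕ.+-mono-≤-< (sum≤n K≤r L≤r) (ℕ.<-≤-trans (ℕ.≤-<-trans s≤r (ℕ.m<m+n r (ℕ.<-≤-trans 0<s s≤r))) r+r≤n))
      where identity : ∀ s L K → s ℤ.+ L - - K ≡ K ℤ.+ L ℤ.+ s
            identity = solve-∀
    from : t ≡ u ⊕ - + K × K + L + s ≡ n → Sphere K u t × Sphere L v t
    from (refl , K+L+s≡n) = inj₂ (shift-⊕ u (- + K)) , inj₁ (meeting-point u→v K+L+s≡n)

  countFin-sphere-meet : ∀ {K L s r} {p q : Fin n → Bool} →
    Triangle K L s → K ≤ r → L ≤ r → s ≤ r → r + r ≤ n → Shift (+ s) u v →
    (∀ t → T (p t) ⇔ Sphere K u t) → (∀ t → T (q t) ⇔ Sphere L v t) →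
    countFin (λ t → p t ∧ q t) ≡ δ (K + L + s) n
  countFin-sphere-meet {u} {K = K} {L} {s} tri K≤r L≤r s≤r r+r≤n u→v p⇔ q⇔ =
    countFin-when (u ⊕ - + K) (K + L + s ℕ.≟ n) λ t →
      sphere-meet tri K≤r L≤r s≤r r+r≤n u→v ⇔-∘ ((p⇔ t ×-⇔ q⇔ t) ⇔-∘ T-∧)

-- Common neighbours of an edge inside one copy, resp. between two copies, of the shadow
-- with 2 + m copies.
λ-within λ-across : ℕ → ℕ → ℕ → ℕ
λ-within n m x = δ 3 n + suc m * δ (x + x + 1) n
λ-across n m x = δ (x + x + 1) n + (δ (x + x + 1) n + m * δ (x + x + x) n)

module ShadowOfCycle {n m x : ℕ} .{{_ : NonZero n}} (1≤x : 1 ≤ x) (x+x≤n : x + x ≤ n) where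

  open import Data.Integer using (+_)
  open Cyclic n
  open Shadow (Cycle n) x

  S : Graph
  S = shadow (suc (suc m)) x (Cycle n)

  T-atDist-flip : ∀ {u w} → T (atDist (Cycle n) x w u) ⇔ Sphere x u w
  T-atDist-flip = sphere-comm ⇔-∘ T-atDist 1≤x x+x≤n

  1+1≤n : 1 + 1 ≤ n
  1+1≤n = ℕ.≤-trans (ℕ.+-mono-≤ 1≤x 1≤x) x+x≤n

  shadow-regular : Regular S
  shadow-regular = _ , λ (i , u) → trans (degree-shadow i u)
    (cong₂ (λ a b → a + suc m * b) (countFin-sphere ℕ.≤-refl 1+1≤n (λ _ → T-cycleAdj))
                                   (countFin-sphere 1≤x x+x≤n (λ _ → T-atDist-flip)))

  x<x+1 : x < x + 1
  x<x+1 = ℕ.m<m+n x ℕ.z<s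
  1<x+x : 1 < x + x
  1<x+x = ℕ.+-mono-≤ 1≤x 1≤x
  x<x+x : x < x + x
  x<x+x = ℕ.m<m+n x 1≤x

  commonNbrs-within : ∀ i {u v} → Shift (+ 1) u v → commonNbrs S (i , u) (i , v) ≡ λ-within n m x
  commonNbrs-within i {u} {v} u→v = trans (commonNbrs-shadow-same i u v) (cong₂ (λ a b → a + suc m * b)
    (countFin-sphere-meet (record { K<L+s = ℕ.≤-refl ; L<K+s = ℕ.≤-refl ; s<K+L = ℕ.≤-refl })
      ℕ.≤-refl ℕ.≤-refl ℕ.≤-refl 1+1≤n u→v (λ _ → T-cycleAdj) (λ _ → T-cycleAdj))
    (countFin-sphere-meet (record { K<L+s = x<x+1 ; L<K+s = x<x+1 ; s<K+L = 1<x+x })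
      ℕ.≤-refl ℕ.≤-refl 1≤x x+x≤n u→v (λ _ → T-atDist-flip) (λ _ → T-atDist-flip)))

  commonNbrs-across : ∀ {i j} → i ≢ j → ∀ {u v} → Shift (+ x) u v →
    commonNbrs S (i , u) (j , v) ≡ λ-across n m x
  commonNbrs-across i≢j {u} {v} u→v = trans (commonNbrs-shadow-diff i≢j u v) (cong₂ _+_
    (trans (countFin-sphere-meet (record { K<L+s = 1<x+x ; L<K+s = ℕ.n<1+n x ; s<K+L = ℕ.n<1+n x })
             1≤x ℕ.≤-refl ℕ.≤-refl x+x≤n u→v (λ _ → T-cycleAdj) (λ _ → T-atDist-flip))
           (cong (λ a → δ a n) (1+x+x≡x+x+1 x)))
    (cong₂ _+_
      (trans (countFin-sphere-meet (record { K<L+s = ℕ.n<1+n x ; L<K+s = 1<x+x ; s<K+L = x<x+1 })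
               ℕ.≤-refl 1≤x ℕ.≤-refl x+x≤n u→v (λ _ → T-atDist-flip) (λ _ → T-cycleAdj))
             (cong (λ a → δ a n) (x+1+x≡x+x+1 x)))
      (cong (m *_) (countFin-sphere-meet (record { K<L+s = x<x+x ; L<K+s = x<x+x ; s<K+L = x<x+x })
        ℕ.≤-refl ℕ.≤-refl ℕ.≤-refl x+x≤n u→v (λ _ → T-atDist-flip) (λ _ → T-atDist-flip)))))
    where
    1+x+x≡x+x+1 : ∀ x → 1 + x + x ≡ x + x + 1
    1+x+x≡x+x+1 = ℕ-Solver.solve-∀
    x+1+x≡x+x+1 : ∀ x → x + 1 + x ≡ x + x + 1
    x+1+x≡x+x+1 = ℕ-Solver.solve-∀

  commonNbrs-edge-within : ∀ i {u v} → adj (Cycle n) u v ≡ true →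
    commonNbrs S (i , u) (i , v) ≡ λ-within n m x
  commonNbrs-edge-within i {u} {v} u~v with sphere-oriented (⇒ T-cycleAdj (⇐ T-≡ u~v))
  ... | inj₁ u→v = commonNbrs-within i u→v
  ... | inj₂ v→u = trans (commonNbrs-comm S (i , u) (i , v)) (commonNbrs-within i v→u)

  commonNbrs-edge-across : ∀ {i j} → i ≢ j → ∀ {u v} → atDist (Cycle n) x v u ≡ true →
    commonNbrs S (i , u) (j , v) ≡ λ-across n m x
  commonNbrs-edge-across {i} {j} i≢j {u} {v} v~u with sphere-oriented (⇒ T-atDist-flip (⇐ T-≡ v~u))
  ... | inj₁ u→v = commonNbrs-across i≢j u→v
  ... | inj₂ v→u = trans (commonNbrs-comm S (i , u) (j , v)) (commonNbrs-across (i≢j ∘ sym) v→u)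

  edgeRegular⇔ : EdgeRegular S ⇔ (λ-within n m x ≡ λ-across n m x)
  edgeRegular⇔ = mk⇔ to from
    where
    u₀ : Fin n
    u₀ = fromℕ< (ℕ.>-nonZero⁻¹ n)
    within-edge : adj S (zero , u₀) (zero , u₀ ⊕ + 1) ≡ true
    within-edge = ⇒ T-≡ (⇐ T-cycleAdj (inj₁ (shift-⊕ u₀ (+ 1))))
    across-edge : adj S (zero , u₀) (suc zero , u₀ ⊕ + x) ≡ true
    across-edge = ⇒ T-≡ (⇐ T-atDist-flip (inj₁ (shift-⊕ u₀ (+ x))))
    to : EdgeRegular S → λ-within n m x ≡ λ-across n m x
    to (_ , λ′ , common≡λ′) = begin
      λ-within n m x
        ≡⟨ commonNbrs-within zero (shift-⊕ u₀ (+ 1)) ⟨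
      commonNbrs S (zero , u₀) (zero , u₀ ⊕ + 1)
        ≡⟨ common≡λ′ (zero , u₀) (zero , u₀ ⊕ + 1) within-edge ⟩
      λ′
        ≡⟨ common≡λ′ (zero , u₀) (suc zero , u₀ ⊕ + x) across-edge ⟨
      commonNbrs S (zero , u₀) (suc zero , u₀ ⊕ + x)
        ≡⟨ commonNbrs-across {zero} {suc zero} (λ ()) (shift-⊕ u₀ (+ x)) ⟩
      λ-across n m x
        ∎
      where open ≡-Reasoning
    from : λ-within n m x ≡ λ-across n m x → EdgeRegular S
    from within≡across = shadow-regular , λ-within n m x , edge
      where
      edge : ∀ p q → adj S p q ≡ true → commonNbrs S p q ≡ λ-within n m x
      edge (i , u) (j , v) e with i ≟ j
      ... | yes refl = commonNbrs-edge-within i e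
      ... | no  i≢j  = trans (commonNbrs-edge-across i≢j e) (sym within≡across)

¬exceptional-1 : ∀ {n m} → ¬ Exceptional n m 1
¬exceptional-1 (_ , 2≤1 , inj₁ (_ , refl , _)) = ℕ.<-irrefl refl 2≤1
¬exceptional-1 (_ , 2≤1 , inj₂ (_ , refl , _)) = ℕ.<-irrefl refl 2≤1

exceptional⇔ : ∀ {n m x} → 2 ≤ x →
  Exceptional n (2 + m) x ⇔ ((x + x + x ≡ n × m ≢ 0) ⊎ (x + x + 1 ≡ n × m ≢ 1))
exceptional⇔ {n} {m} {x} 2≤x = mk⇔ to from
  where
  3x≡ : ∀ x → 3 * x ≡ x + x + x
  3x≡ = ℕ-Solver.solve-∀
  2x+1≡ : ∀ x → 2 * x + 1 ≡ x + x + 1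
  2x+1≡ = ℕ-Solver.solve-∀
  to : Exceptional n (2 + m) x → (x + x + x ≡ n × m ≢ 0) ⊎ (x + x + 1 ≡ n × m ≢ 1)
  to (_ , _ , inj₁ (n≡3x , refl , 2+m≢2)) =
    inj₁ (sym (trans n≡3x (3x≡ x)) , 2+m≢2 ∘ cong (λ k → 2 + k))
  to (_ , _ , inj₂ (n≡2x+1 , refl , 2+m≢3)) =
    inj₂ (sym (trans n≡2x+1 (2x+1≡ x)) , 2+m≢3 ∘ cong (λ k → 2 + k))
  from : (x + x + x ≡ n × m ≢ 0) ⊎ (x + x + 1 ≡ n × m ≢ 1) → Exceptional n (2 + m) x
  from (inj₁ (3x≡n , m≢0)) =
    x , 2≤x , inj₁ (trans (sym 3x≡n) (sym (3x≡ x)) , refl , m≢0 ∘ ℕ.+-cancelˡ-≡ 2 m 0)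
  from (inj₂ (2x+1≡n , m≢1)) =
    x , 2≤x , inj₂ (trans (sym 2x+1≡n) (sym (2x+1≡ x)) , refl , m≢1 ∘ ℕ.+-cancelˡ-≡ 2 m 1)

by-δ-values : ∀ {n m x a b c} {Q : Set} → δ 3 n ≡ a → δ (x + x + 1) n ≡ b → δ (x + x + x) n ≡ c →
  (a + suc m * b ≡ b + (b + m * c)) ⇔ Q → (λ-within n m x ≡ λ-across n m x) ⇔ Q
by-δ-values refl refl refl within≡across⇔Q = within≡across⇔Q

λ-within≡λ-across⇔-2≤x : ∀ {n m x} → 2 ≤ x → x + x ≤ n →
  (λ-within n m x ≡ λ-across n m x) ⇔ (¬ Exceptional n (2 + m) x)
λ-within≡λ-across⇔-2≤x {n} {m} {x} 2≤x x+x≤n = by-cases (x + x + 1 ℕ.≟ n) (x + x + x ℕ.≟ n)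
  where
  3≢n : 3 ≢ n
  3≢n = ℕ.<⇒≢ (ℕ.≤-trans (ℕ.+-mono-≤ 2≤x 2≤x) x+x≤n)
  by-cases : Dec (x + x + 1 ≡ n) → Dec (x + x + x ≡ n) →
    (λ-within n m x ≡ λ-across n m x) ⇔ (¬ Exceptional n (2 + m) x)
  by-cases (yes 2x+1≡n) (yes 3x≡n) =
    contradiction (ℕ.+-cancelˡ-≡ (x + x) 1 x (trans 2x+1≡n (sym 3x≡n))) (ℕ.<⇒≢ 2≤x)
  by-cases (yes 2x+1≡n) (no 3x≢n) =
    by-δ-values {n} {m} {x} (δ-≢ 3≢n) (δ-≡ 2x+1≡n) (δ-≢ 3x≢n) (mk⇔ to from)
    where
    to : suc (m * 1) ≡ suc (suc (m * 0)) → ¬ Exceptional n (2 + m) x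
    to eq exc = [ (λ (3x≡n , _) → 3x≢n 3x≡n) , (λ (_ , m≢1) → m≢1 m≡1) ]′ (⇒ (exceptional⇔ 2≤x) exc)
      where m≡1 = trans (sym (ℕ.*-identityʳ m)) (trans (ℕ.suc-injective eq) (cong suc (ℕ.*-zeroʳ m)))
    from : ¬ Exceptional n (2 + m) x → suc (m * 1) ≡ suc (suc (m * 0))
    from ¬exc with m ℕ.≟ 1
    ... | yes refl = refl
    ... | no  m≢1  = contradiction (⇐ (exceptional⇔ 2≤x) (inj₂ (2x+1≡n , m≢1))) ¬exc
  by-cases (no 2x+1≢n) (yes 3x≡n) =
    by-δ-values {n} {m} {x} (δ-≢ 3≢n) (δ-≢ 2x+1≢n) (δ-≡ 3x≡n) (mk⇔ to from)
    where
    to : m * 0 ≡ m * 1 → ¬ Exceptional n (2 + m) x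
    to eq exc = [ (λ (_ , m≢0) → m≢0 m≡0) , (λ (2x+1≡n , _) → 2x+1≢n 2x+1≡n) ]′ (⇒ (exceptional⇔ 2≤x) exc)
      where m≡0 = trans (sym (ℕ.*-identityʳ m)) (trans (sym eq) (ℕ.*-zeroʳ m))
    from : ¬ Exceptional n (2 + m) x → m * 0 ≡ m * 1
    from ¬exc with m ℕ.≟ 0
    ... | yes refl = refl
    ... | no  m≢0  = contradiction (⇐ (exceptional⇔ 2≤x) (inj₁ (3x≡n , m≢0))) ¬exc
  by-cases (no 2x+1≢n) (no 3x≢n) =
    by-δ-values {n} {m} {x} (δ-≢ 3≢n) (δ-≢ 2x+1≢n) (δ-≢ 3x≢n)
      (mk⇔ (λ _ → [ 3x≢n ∘ proj₁ , 2x+1≢n ∘ proj₁ ]′ ∘ ⇒ (exceptional⇔ 2≤x)) (λ _ → refl))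

λ-within≡λ-across⇔ : ∀ {n m x} → 1 ≤ x → x + x ≤ n →
  (λ-within n m x ≡ λ-across n m x) ⇔ (¬ Exceptional n (2 + m) x)
λ-within≡λ-across⇔ {x = 1}           _ _     = mk⇔ (λ _ → ¬exceptional-1) (λ _ → refl)
λ-within≡λ-across⇔ {x = suc (suc _)} _ x+x≤n = λ-within≡λ-across⇔-2≤x (s≤s (s≤s z≤n)) x+x≤n

x≤n/2⇒x+x≤n : ∀ {n x} → x ≤ n / 2 → x + x ≤ n
x≤n/2⇒x+x≤n {n} {x} x≤n/2 =
  ℕ.≤-trans (ℕ.≤-reflexive (x+x≡x*2 x)) (ℕ.≤-trans (ℕ.*-monoˡ-≤ 2 x≤n/2) (m/n*n≤m n 2))
  where x+x≡x*2 : ∀ x → x + x ≡ x * 2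
        x+x≡x*2 = ℕ-Solver.solve-∀

corollary2p5 : (n m x : ℕ) → 3 ≤ n → 2 ≤ m → 1 ≤ x → x ≤ n / 2 →
    (EdgeRegular (shadow m x (Cycle n)) ⇔ (¬ Exceptional n m x))
corollary2p5 n m x (s≤s _) (s≤s (s≤s _)) 1≤x x≤n/2 =
  λ-within≡λ-across⇔ 1≤x x+x≤n ⇔-∘ ShadowOfCycle.edgeRegular⇔ 1≤x x+x≤n
  where x+x≤n = x≤n/2⇒x+x≤n {n} x≤n/2
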